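{- Let $n \ge 3$ be an odd integer, let $i \in \{1,2,3,4\}$, and let $G = C_2^i \oplus C_{2n}^{5-i}$. Then $\mathsf d(G) > \mathsf d^*(G)$.
   Context: For $m \in \mathbb N$, $C_m$ denotes a cyclic group of order $m$. For a finite abelian group $G = C_{n_1} \oplus \ldots \oplus C_{n_r}$ with $1 < n_1 \mid \ldots \mid n_r$ (so $r$ is the rank of $G$), set $\mathsf d^*(G) = \sum_{j=1}^r (n_j - 1)$ (and $\mathsf d^*(G)=0$ if $G$ is trivial). A sequence over $G$ is a finite unordered list of elements of $G$ with repetition allowed (an element of the free abelian monoid on $G$); it is zero-sum free if no non-empty subsequence has sum $0$. $\mathsf d(G)$ denotes the maximal length of a zero-sum free sequence over $G$ (so $\mathsf d(G)+1$ is the Davenport constant of $G$). -}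

module Defs where

open import Data.Nat using (ℕ; _∸_; _*_; _≤_)
open import Data.Nat.Divisibility using (_∣_)
open import Data.Nat.ListAction using (sum)
open import Data.Fin using (Fin; toℕ)
open import Data.List using (List; []; _∷_; length; lookup; map; replicate; _++_)
open import Data.List.Relation.Binary.Sublist.Propositional using (_⊆_)
open import Data.Product using (Σ; _×_)
open import Relation.Binary.PropositionalEquality using (_≡_)
open import Relation.Nullary using (¬_)

-- The finite abelian group C_{m_1} ⊕ … ⊕ C_{m_r}, given by its list of cyclic orders.
-- An element is a tuple of residues, component k living in Fin m_k (= ℤ/m_k).
Elem : List ℕ → Set
Elem ms = (k : Fin (length ms)) → Fin (lookup ms k)

-- A sequence over G: a finite list of group elements (order is irrelevant for all notions below).
Seq : List ℕ → Set
Seq ms = List (Elem ms)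

coordSum : (ms : List ℕ) → Seq ms → Fin (length ms) → ℕ
coordSum ms S k = sum (map (λ g → toℕ (g k)) S)

IsZeroSum : (ms : List ℕ) → Seq ms → Set
IsZeroSum ms S = (k : Fin (length ms)) → lookup ms k ∣ coordSum ms S k

ZeroSumFree : (ms : List ℕ) → Seq ms → Set
ZeroSumFree ms S = (T : Seq ms) → T ⊆ S → ¬ (T ≡ []) → ¬ IsZeroSum ms T

IsSmallD : (ms : List ℕ) → ℕ → Set
IsSmallD ms d =
  Σ (Seq ms) (λ S → ZeroSumFree ms S × length S ≡ d)
  × ((S : Seq ms) → ZeroSumFree ms S → length S ≤ d)

-- 𝖽*(G) = Σ (n_j - 1), for G given in invariant-factor form 1 < n_1 ∣ … ∣ n_r.
dStar : List ℕ → ℕ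
dStar ms = sum (map (λ m → m ∸ 1) ms)

-- C_2^i ⊕ C_{2n}^{5-i}  (invariant-factor form, since 2 ∣ 2n)
moduli : ℕ → ℕ → List ℕ
moduli n i = replicate i 2 ++ replicate (5 ∸ i) (2 * n)

-- Write n = 2m + 1. On every C_{2n}-coordinate place a run of 2n − 1 − w copies of the unit vector;
-- its nonempty subsums lie in [1, 2n − 1 − w]. Then add a few extra elements with entries a + b·m.
-- Each nonempty set of extras is certified by one coordinate: a C₂-coordinate where its sum is odd,
-- or a window coordinate where 4 ∣ b, so that (as 4m ≡ −2 mod 2n) its sum is a − b/2 ∈ [1, w] and
-- no part of the run can complete it to a multiple of 2n. The certificates do not depend on n and
-- are checked by evaluation. The sequence has length Σ (2n − 1 − w) + #extras, which exceeds
-- 𝖽*(G) = Σ (2n − 1) + i as soon as #extras > i + Σ w.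
module Submission where

open import Defs
open import Data.Nat using (ℕ; _≤_; _<_)
open import Data.Nat.Divisibility using (_∣_)
open import Relation.Nullary using (¬_)

open import Data.Empty using (⊥-elim)
open import Data.Fin using (Fin; zero; suc)
open import Data.Fin.Properties using (any?; toℕ-fromℕ<)
open import Data.List using (List; []; _∷_; length; lookup; map; replicate; _++_)
open import Data.List.Properties using (length-++; length-map; length-replicate; map-++; ++-identityʳ)
open import Data.List.Relation.Binary.Sublist.Heterogeneous using ([]; _∷_; _∷ʳ_)
open import Data.List.Relation.Binary.Sublist.Propositional using (_⊆_)
open import Data.List.Relation.Binary.Sublist.Propositional.Properties using (All-resp-⊆)
open import Data.List.Relation.Unary.All as All using (All; []; _∷_; all?)
open import Data.List.Relation.Unary.All.Properties using (++⁺; map⁺; replicate⁺)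
open import Data.Nat using (suc; _+_; _*_; _∸_; _/_; _%_; NonZero; >-nonZero; z≤n; s≤s; s≤s⁻¹; _≤?_; _<?_)
open import Data.Nat.Divisibility
  using (divides-refl; _∣?_; >⇒∤; ∣m+n∣m⇒∣n; ∣m∣n⇒∣m+n; ∣m⇒∣m*n; n∣m*n; m%n≡0⇒n∣m; n∣m⇒m%n≡0)
open import Data.Nat.DivMod using (_mod_; %-distribˡ-+; m%n%n≡m%n; m*n/n≡m)
open import Data.Nat.ListAction using (sum)
open import Data.Nat.ListAction.Properties using (sum-++)
open import Data.Nat.Properties
open import Algebra.Properties.CommutativeSemigroup +-commutativeSemigroup using (interchange)
open import Data.Nat.Tactic.RingSolver using (solve-∀)
open import Data.Product using (_×_; _,_; proj₁; proj₂; ∃-syntax; ∃₂)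
open import Data.Unit using (⊤; tt)
open import Data.Vec as Vec using (Vec; []; _∷_)
open import Data.Vec.Properties using (lookup-map; lookup-replicate)
open import Function using (_∘_)
open import Relation.Binary.PropositionalEquality
open import Relation.Nullary.Decidable using (Dec; yes; _×-dec_; ¬?; True; toWitness)

private variable
  A B : Set
  r : ℕ

⊆-map⁻ : (f : A → B) (xs : List A) {ys : List B} → ys ⊆ map f xs → ∃[ zs ] zs ⊆ xs × ys ≡ map f zs
⊆-map⁻ f []       []         = [] , [] , refl
⊆-map⁻ f (x ∷ xs) (_ ∷ʳ p)   with ⊆-map⁻ f xs p
... | zs , q , refl = zs , x ∷ʳ q , refl
⊆-map⁻ f (x ∷ xs) (refl ∷ p) with ⊆-map⁻ f xs p
... | zs , q , refl = x ∷ zs , refl ∷ q , refl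

⊆-++⁻ : (xs : List A) {zs ys : List A} → ys ⊆ xs ++ zs →
        ∃₂ λ ys₁ ys₂ → ys ≡ ys₁ ++ ys₂ × ys₁ ⊆ xs × ys₂ ⊆ zs
⊆-++⁻ []       p          = [] , _ , refl , [] , p
⊆-++⁻ (x ∷ xs) (_ ∷ʳ p)   with ⊆-++⁻ xs p
... | ys₁ , ys₂ , refl , p₁ , p₂ = ys₁ , ys₂ , refl , x ∷ʳ p₁ , p₂
⊆-++⁻ (x ∷ xs) (refl ∷ p) with ⊆-++⁻ xs p
... | ys₁ , ys₂ , refl , p₁ , p₂ = x ∷ ys₁ , ys₂ , refl , refl ∷ p₁ , p₂

sum-map-mono-⊆ : (f : A → ℕ) {xs ys : List A} → ys ⊆ xs → sum (map f ys) ≤ sum (map f xs)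
sum-map-mono-⊆ f []         = ≤-refl
sum-map-mono-⊆ f (x ∷ʳ p)   = ≤-trans (sum-map-mono-⊆ f p) (m≤n+m _ (f x))
sum-map-mono-⊆ f (refl ∷ p) = +-monoʳ-≤ _ (sum-map-mono-⊆ f p)

sum-map-% : (f : A → ℕ) (M : ℕ) .{{_ : NonZero M}} (xs : List A) →
            sum (map (λ x → f x % M) xs) % M ≡ sum (map f xs) % M
sum-map-% f M []       = refl
sum-map-% f M (x ∷ xs) = begin
  (f x % M + s%) % M         ≡⟨ %-distribˡ-+ (f x % M) s% M ⟩
  (f x % M % M + s% % M) % M ≡⟨ cong₂ (λ a b → (a + b) % M) (m%n%n≡m%n (f x) M) (sum-map-% f M xs) ⟩
  (f x % M + s % M) % M      ≡⟨ %-distribˡ-+ (f x) s M ⟨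
  (f x + s) % M              ∎
  where
  open ≡-Reasoning
  s% = sum (map (λ x → f x % M) xs)
  s  = sum (map f xs)

EverySublist : (List A → Set) → List A → Set
EverySublist P []       = P []
EverySublist P (x ∷ xs) = EverySublist P xs × EverySublist (P ∘ (x ∷_)) xs

everySublist? : {P : List A → Set} → (∀ ys → Dec (P ys)) → ∀ xs → Dec (EverySublist P xs)
everySublist? P? []       = P? []
everySublist? P? (x ∷ xs) = everySublist? P? xs ×-dec everySublist? (P? ∘ (x ∷_)) xs

EverySublist⇒ : {P : List A → Set} {xs ys : List A} → EverySublist P xs → ys ⊆ xs → P ys
EverySublist⇒ p          []         = p
EverySublist⇒ (p , _)    (_ ∷ʳ q)   = EverySublist⇒ p q
EverySublist⇒ (_ , p)    (refl ∷ q) = EverySublist⇒ p q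

column : Fin r → List (Vec A r) → List A
column k = map (λ v → Vec.lookup v k)

columnSum : Fin r → List (Vec ℕ r) → ℕ
columnSum k = sum ∘ column k

columnSum-++ : (k : Fin r) (us vs : List (Vec ℕ r)) → columnSum k (us ++ vs) ≡ columnSum k us + columnSum k vs
columnSum-++ k us vs = trans (cong sum (map-++ _ us vs)) (sum-++ (column k us) (column k vs))

module Residues (ms : List ℕ) (nonZero : ∀ k → NonZero (lookup ms k)) where

  private instance
    nonZeroₖ : ∀ {k} → NonZero (lookup ms k)
    nonZeroₖ {k} = nonZero k

  residues : Vec ℕ (length ms) → Elem ms
  residues v k = Vec.lookup v k mod lookup ms k

  coordSum-residues : ∀ k vs → coordSum ms (map residues vs) k ≡ sum (map (λ v → Vec.lookup v k % lookup ms k) vs)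
  coordSum-residues k []       = refl
  coordSum-residues k (v ∷ vs) = cong₂ _+_ (toℕ-fromℕ< _) (coordSum-residues k vs)

  zeroSum⇒∣columnSum : ∀ vs → IsZeroSum ms (map residues vs) → ∀ k → lookup ms k ∣ columnSum k vs
  zeroSum⇒∣columnSum vs zeroSum k = m%n≡0⇒n∣m _ _ (begin
    columnSum k vs % M                          ≡⟨ sum-map-% (λ v → Vec.lookup v k) M vs ⟨
    sum (map (λ v → Vec.lookup v k % M) vs) % M ≡⟨ n∣m⇒m%n≡0 _ M (subst (M ∣_) (coordSum-residues k vs) (zeroSum k)) ⟩
    0                                           ∎)
    where
    open ≡-Reasoning
    M = lookup ms k

sumPairs : List (ℕ × ℕ) → ℕ × ℕ
sumPairs ps = sum (map proj₁ ps) , sum (map proj₂ ps)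

-- A coordinate C₂, or a coordinate C_{2n} carrying a run of 2n − 1 − w unit vectors, which leaves
-- the residues 1, …, w as a window for the extra elements.
data Kind : Set where
  order-two : Kind
  window    : ℕ → Kind

slack : Kind → ℕ
slack order-two  = 1
slack (window w) = w

Certifies : Kind → ℕ × ℕ → Set
Certifies order-two  (a , b) = 2 ∣ b × ¬ 2 ∣ a
Certifies (window w) (a , b) = 4 ∣ b × b / 2 < a × a ≤ w + b / 2

certifies? : ∀ κ p → Dec (Certifies κ p)
certifies? order-two  (a , b) = 2 ∣? b ×-dec ¬? (2 ∣? a)
certifies? (window w) (a , b) = 4 ∣? b ×-dec b / 2 <? a ×-dec a ≤? w + b / 2

module Construction (m : ℕ) where

  n : ℕ
  n = suc (2 * m)

  evaluate : ℕ × ℕ → ℕ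
  evaluate (a , b) = a + b * m

  evaluate-sumPairs : ∀ ps → evaluate (sumPairs ps) ≡ sum (map evaluate ps)
  evaluate-sumPairs []             = refl
  evaluate-sumPairs ((a , b) ∷ ps) =
    trans (regroup a (sum (map proj₁ ps)) b (sum (map proj₂ ps)) m)
          (cong (evaluate (a , b) +_) (evaluate-sumPairs ps))
    where
    regroup : ∀ a a′ b b′ m → (a + a′) + (b + b′) * m ≡ (a + b * m) + (a′ + b′ * m)
    regroup = solve-∀

  2∤a+b*m : ∀ {a b} → 2 ∣ b → ¬ 2 ∣ a → ¬ 2 ∣ a + b * m
  2∤a+b*m {a} {b} 2∣b 2∤a 2∣a+bm =
    2∤a (∣m+n∣m⇒∣n (subst (2 ∣_) (+-comm a (b * m)) 2∣a+bm) (∣m⇒∣m*n m 2∣b))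

  -- Since 4m ≡ -2 (mod 2n), a + 4q·m ≡ a - 2q.
  window-residue : ∀ a q → q * 4 / 2 ≤ a → a + q * 4 * m ≡ (a ∸ q * 4 / 2) + q * 4 / 4 * (2 * n)
  window-residue a q half≤a = begin
    a + q * 4 * m                         ≡⟨ cong (_+ q * 4 * m) (m+[n∸m]≡n half≤a) ⟨
    (q * 4 / 2 + t) + q * 4 * m           ≡⟨ cong (λ h → (h + t) + q * 4 * m) half ⟩
    (q * 2 + t) + q * 4 * m               ≡⟨ regroup q t m ⟩
    t + q * (2 * n)                       ≡⟨ cong (λ x → t + x * (2 * n)) (m*n/n≡m q 4) ⟨
    t + q * 4 / 4 * (2 * n)               ∎
    where
    open ≡-Reasoning
    t = a ∸ q * 4 / 2
    half : q * 4 / 2 ≡ q * 2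
    half = trans (cong (_/ 2) (sym (*-assoc q 2 2))) (m*n/n≡m (q * 2) 2)
    regroup : ∀ q t m → (q * 2 + t) + q * 4 * m ≡ t + q * (2 * suc (2 * m))
    regroup = solve-∀

  2n∤c+[a+b*m] : ∀ {a b c w} → 4 ∣ b → b / 2 < a → a ≤ w + b / 2 → c + w < 2 * n → ¬ 2 * n ∣ c + (a + b * m)
  2n∤c+[a+b*m] {a} {b@.(q * 4)} {c} {w} (divides-refl q) lo hi bound 2n∣ =
    >⇒∤ {{>-nonZero 0<c+t}} c+t<2n (∣m+n∣m⇒∣n (subst (2 * n ∣_) residue 2n∣) (n∣m*n (b / 4)))
    where
    t = a ∸ b / 2
    residue : c + (a + b * m) ≡ b / 4 * (2 * n) + (c + t)
    residue = begin
      c + (a + b * m)                   ≡⟨ cong (c +_) (window-residue a q (<⇒≤ lo)) ⟩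
      c + (t + b / 4 * (2 * n))         ≡⟨ +-assoc c t _ ⟨
      (c + t) + b / 4 * (2 * n)         ≡⟨ +-comm (c + t) _ ⟩
      b / 4 * (2 * n) + (c + t)         ∎
      where open ≡-Reasoning
    0<c+t : 0 < c + t
    0<c+t = ≤-trans (m<n⇒0<n∸m lo) (m≤n+m t c)
    c+t<2n : c + t < 2 * n
    c+t<2n = ≤-<-trans (+-monoʳ-≤ c (subst (t ≤_) (m+n∸n≡m w (b / 2)) (∸-monoˡ-≤ (b / 2) hi))) bound

  modulus : Kind → ℕ
  modulus order-two  = 2
  modulus (window w) = 2 * n

  runLength : Kind → ℕ
  runLength order-two  = 0
  runLength (window w) = 2 * n ∸ suc w

  modulus∸1 : ∀ κ → slack κ < 2 * n → modulus κ ∸ 1 ≡ runLength κ + slack κ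
  modulus∸1 order-two  _    = refl
  modulus∸1 (window w) w<2n = sym (m∸n+n≡m (s≤s⁻¹ w<2n))

  modulus∤run : ∀ κ {c} → 0 < c → c ≤ runLength κ → ¬ modulus κ ∣ c
  modulus∤run order-two  0<c c≤0 _ = <⇒≱ 0<c c≤0
  modulus∤run (window w) 0<c c≤L   = >⇒∤ {{>-nonZero 0<c}} (s≤s (≤-trans c≤L (m∸n≤m _ w)))

  modulus∤certified : ∀ κ {a b c} → slack κ < 2 * n → Certifies κ (a , b) → c ≤ runLength κ →
                      ¬ modulus κ ∣ c + evaluate (a , b)
  modulus∤certified order-two  _    (2∣b , 2∤a) c≤0 rewrite n≤0⇒n≡0 c≤0 = 2∤a+b*m 2∣b 2∤a
  modulus∤certified (window w) w<2n (4∣b , lo , hi) c≤L =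
    2n∤c+[a+b*m] 4∣b lo hi (s≤s (≤-trans (+-monoˡ-≤ w c≤L) (≤-reflexive (m∸n+n≡m (s≤s⁻¹ w<2n)))))

  moduliOf : List Kind → List ℕ
  moduliOf = map modulus

  Coord : List Kind → Set
  Coord ks = Fin (length (moduliOf ks))

  kindAt : (ks : List Kind) → Coord ks → Kind
  kindAt (κ ∷ ks) zero    = κ
  kindAt (κ ∷ ks) (suc k) = kindAt ks k

  lookup-moduliOf : ∀ ks k → lookup (moduliOf ks) k ≡ modulus (kindAt ks k)
  lookup-moduliOf (κ ∷ ks) zero    = refl
  lookup-moduliOf (κ ∷ ks) (suc k) = lookup-moduliOf ks k

  All-kindAt : {P : Kind → Set} {ks : List Kind} → All P ks → ∀ k → P (kindAt ks k)
  All-kindAt (p ∷ _)  zero    = p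
  All-kindAt (_ ∷ ps) (suc k) = All-kindAt ps k

  nonZero-moduliOf : ∀ ks k → NonZero (lookup (moduliOf ks) k)
  nonZero-moduliOf (order-two  ∷ ks) zero    = _
  nonZero-moduliOf (window w   ∷ ks) zero    = _
  nonZero-moduliOf (κ          ∷ ks) (suc k) = nonZero-moduliOf ks k

  runs : (ks : List Kind) → List (Vec ℕ (length (moduliOf ks)))
  runs []       = []
  runs (κ ∷ ks) = replicate (runLength κ) (1 ∷ Vec.replicate _ 0) ++ map (0 ∷_) (runs ks)

  columnSum-replicate : (k : Fin r) (L : ℕ) (v : Vec ℕ r) → columnSum k (replicate L v) ≡ L * Vec.lookup v k
  columnSum-replicate k 0       v = refl
  columnSum-replicate k (suc L) v = cong (Vec.lookup v k +_) (columnSum-replicate k L v)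

  columnSum-shift-zero : (vs : List (Vec ℕ r)) → columnSum zero (map (0 ∷_) vs) ≡ 0
  columnSum-shift-zero []       = refl
  columnSum-shift-zero (v ∷ vs) = columnSum-shift-zero vs

  columnSum-shift-suc : (k : Fin r) (vs : List (Vec ℕ r)) → columnSum (suc k) (map (0 ∷_) vs) ≡ columnSum k vs
  columnSum-shift-suc k []       = refl
  columnSum-shift-suc k (v ∷ vs) = cong (Vec.lookup v k +_) (columnSum-shift-suc k vs)

  columnSum-runs : ∀ ks k → columnSum k (runs ks) ≡ runLength (kindAt ks k)
  columnSum-runs (κ ∷ ks) zero = begin
    columnSum zero (replicate L e ++ map (0 ∷_) (runs ks))
      ≡⟨ columnSum-++ zero (replicate L e) _ ⟩
    columnSum zero (replicate L e) + columnSum zero (map (0 ∷_) (runs ks))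
      ≡⟨ cong₂ _+_ (columnSum-replicate zero L e) (columnSum-shift-zero (runs ks)) ⟩
    L * 1 + 0
      ≡⟨ trans (+-identityʳ _) (*-identityʳ L) ⟩
    L ∎
    where
    open ≡-Reasoning
    L = runLength κ
    e = 1 ∷ Vec.replicate _ 0
  columnSum-runs (κ ∷ ks) (suc k) = begin
    columnSum (suc k) (replicate L e ++ map (0 ∷_) (runs ks))
      ≡⟨ columnSum-++ (suc k) (replicate L e) _ ⟩
    columnSum (suc k) (replicate L e) + columnSum (suc k) (map (0 ∷_) (runs ks))
      ≡⟨ cong₂ _+_ (columnSum-replicate (suc k) L e) (columnSum-shift-suc k (runs ks)) ⟩
    L * Vec.lookup (Vec.replicate _ 0) k + columnSum k (runs ks)
      ≡⟨ cong₂ _+_ (trans (cong (L *_) (lookup-replicate k 0)) (*-zeroʳ L)) (columnSum-runs ks k) ⟩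
    runLength (kindAt ks k) ∎
    where
    open ≡-Reasoning
    L = runLength κ
    e = 1 ∷ Vec.replicate _ 0

  runs-nonzero : ∀ ks → All (λ v → ∃[ k ] 0 < Vec.lookup v k) (runs ks)
  runs-nonzero []       = []
  runs-nonzero (κ ∷ ks) =
    ++⁺ (replicate⁺ (runLength κ) (zero , s≤s z≤n))
        (map⁺ (All.map (λ (k , p) → suc k , p) (runs-nonzero ks)))

  length-runs : ∀ ks → length (runs ks) ≡ sum (map runLength ks)
  length-runs []       = refl
  length-runs (κ ∷ ks) = begin
    length (replicate (runLength κ) _ ++ map (0 ∷_) (runs ks))
      ≡⟨ length-++ (replicate (runLength κ) _) ⟩
    length (replicate (runLength κ) _) + length (map (0 ∷_) (runs ks))
      ≡⟨ cong₂ _+_ (length-replicate (runLength κ)) (trans (length-map _ (runs ks)) (length-runs ks)) ⟩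
    runLength κ + sum (map runLength ks) ∎
    where open ≡-Reasoning

  columnSum-evaluate : ∀ (k : Fin r) xs →
                       columnSum k (map (Vec.map evaluate) xs) ≡ evaluate (sumPairs (column k xs))
  columnSum-evaluate k xs = trans (go xs) (sym (evaluate-sumPairs (column k xs)))
    where
    go : ∀ xs → columnSum k (map (Vec.map evaluate) xs) ≡ sum (map evaluate (column k xs))
    go []       = refl
    go (x ∷ xs) = cong₂ _+_ (lookup-map k evaluate x) (go xs)

  -- An extra element is recorded coordinatewise by pairs (a, b) standing for a + b·(n − 1)/2,
  -- so one list of pairs describes a sequence for every odd n at once.
  Extras : List Kind → Set
  Extras ks = List (Vec (ℕ × ℕ) (length (moduliOf ks)))

  rawSequence : (ks : List Kind) → Extras ks → List (Vec ℕ (length (moduliOf ks)))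
  rawSequence ks xs = runs ks ++ map (Vec.map evaluate) xs

  residuesOf : (ks : List Kind) → Vec ℕ (length (moduliOf ks)) → Elem (moduliOf ks)
  residuesOf ks = Residues.residues (moduliOf ks) (nonZero-moduliOf ks)

  sequence : (ks : List Kind) → Extras ks → Seq (moduliOf ks)
  sequence ks xs = map (residuesOf ks) (rawSequence ks xs)

  Narrow : List Kind → Set
  Narrow = All (λ κ → slack κ < 2 * n)

  Certified : (ks : List Kind) → Extras ks → Set
  Certified ks []         = ⊤
  Certified ks xs@(_ ∷ _) = ∃[ k ] Certifies (kindAt ks k) (sumPairs (column k xs))

  certified? : ∀ ks xs → Dec (Certified ks xs)
  certified? ks []         = yes tt
  certified? ks xs@(_ ∷ _) = any? (λ k → certifies? (kindAt ks k) (sumPairs (column k xs)))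

  ZeroColumns : (ks : List Kind) → List (Vec ℕ (length (moduliOf ks))) → Set
  ZeroColumns ks vs = ∀ k → modulus (kindAt ks k) ∣ columnSum k vs

  module _ {ks : List Kind} where

    columnSum-⊆runs : ∀ {R} k → R ⊆ runs ks → columnSum k R ≤ runLength (kindAt ks k)
    columnSum-⊆runs k R⊆ =
      ≤-trans (sum-map-mono-⊆ (λ v → Vec.lookup v k) R⊆) (≤-reflexive (columnSum-runs ks k))

    ¬ZeroColumns-runs : ∀ {R} → R ⊆ runs ks → ¬ R ≡ [] → ¬ ZeroColumns ks R
    ¬ZeroColumns-runs {[]}    _  R≢[] _    = R≢[] refl
    ¬ZeroColumns-runs {v ∷ R} R⊆ _    zeroCols with All-resp-⊆ R⊆ (runs-nonzero ks)
    ... | (k , 0<vₖ) ∷ _ =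
      modulus∤run (kindAt ks k) (≤-trans 0<vₖ (m≤m+n _ _)) (columnSum-⊆runs k R⊆) (zeroCols k)

    ¬ZeroColumns-certified : ∀ {R u U} → Narrow ks → R ⊆ runs ks → Certified ks (u ∷ U) →
                         ¬ ZeroColumns ks (R ++ map (Vec.map evaluate) (u ∷ U))
    ¬ZeroColumns-certified {R} {u} {U} narrow R⊆ (k , c) zeroCols =
      modulus∤certified (kindAt ks k) (All-kindAt narrow k) c (columnSum-⊆runs k R⊆)
        (subst (_ ∣_) columns (zeroCols k))
      where
      columns : columnSum k (R ++ map (Vec.map evaluate) (u ∷ U)) ≡ columnSum k R + evaluate (sumPairs (column k (u ∷ U)))
      columns = trans (columnSum-++ k R _) (cong (columnSum k R +_) (columnSum-evaluate k (u ∷ U)))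

    ¬ZeroColumns-sublist : ∀ {R U xs} → Narrow ks → EverySublist (Certified ks) xs →
                   R ⊆ runs ks → U ⊆ xs → ¬ (R ≡ [] × U ≡ []) → ¬ ZeroColumns ks (R ++ map (Vec.map evaluate) U)
    ¬ZeroColumns-sublist {R} {[]}    _      _         R⊆ _  nonempty zeroCols =
      ¬ZeroColumns-runs R⊆ (λ R≡[] → nonempty (R≡[] , refl)) (subst (ZeroColumns ks) (++-identityʳ R) zeroCols)
    ¬ZeroColumns-sublist {U = _ ∷ _} narrow certified R⊆ U⊆ _ =
      ¬ZeroColumns-certified narrow R⊆ (EverySublist⇒ certified U⊆)

    sequence-zeroSumFree : ∀ {xs} → Narrow ks → EverySublist (Certified ks) xs →
                           ZeroSumFree (moduliOf ks) (sequence ks xs)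
    sequence-zeroSumFree {xs} narrow certified T T⊆ T≢[] zeroSum
      with ⊆-map⁻ (residuesOf ks) (rawSequence ks xs) T⊆
    ... | Y , Y⊆ , refl with ⊆-++⁻ (runs ks) Y⊆
    ... | R , V , refl , R⊆ , V⊆ with ⊆-map⁻ (Vec.map evaluate) xs V⊆
    ... | U , U⊆ , refl =
      ¬ZeroColumns-sublist narrow certified R⊆ U⊆ (λ { (refl , refl) → T≢[] refl }) λ k →
        subst (_∣ columnSum k vs) (lookup-moduliOf ks k) (zeroSum⇒∣columnSum vs zeroSum k)
      where
      open Residues (moduliOf ks) (nonZero-moduliOf ks) using (zeroSum⇒∣columnSum)
      vs = R ++ map (Vec.map evaluate) U

  dStar-moduliOf : ∀ {ks} → Narrow ks →
                   dStar (moduliOf ks) ≡ sum (map runLength ks) + sum (map slack ks)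
  dStar-moduliOf {[]}     []       = refl
  dStar-moduliOf {κ ∷ ks} (p ∷ ps) =
    trans (cong₂ _+_ (modulus∸1 κ p) (dStar-moduliOf ps))
          (interchange (runLength κ) (slack κ) (sum (map runLength ks)) (sum (map slack ks)))

  length-sequence : ∀ ks xs → length (sequence ks xs) ≡ sum (map runLength ks) + length xs
  length-sequence ks xs = begin
    length (sequence ks xs)                               ≡⟨ length-map _ (rawSequence ks xs) ⟩
    length (rawSequence ks xs)                            ≡⟨ length-++ (runs ks) ⟩
    length (runs ks) + length (map (Vec.map evaluate) xs) ≡⟨ cong₂ _+_ (length-runs ks) (length-map _ xs) ⟩
    sum (map runLength ks) + length xs                    ∎
    where open ≡-Reasoning

  dStar<d : ∀ {ks xs d} → Narrow ks → EverySublist (Certified ks) xs →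
            sum (map slack ks) < length xs → IsSmallD (moduliOf ks) d → dStar (moduliOf ks) < d
  dStar<d {ks} {xs} {d} narrow certified short (_ , maximal) = begin-strict
    dStar (moduliOf ks)                         ≡⟨ dStar-moduliOf narrow ⟩
    sum (map runLength ks) + sum (map slack ks) <⟨ +-monoʳ-< _ short ⟩
    sum (map runLength ks) + length xs          ≡⟨ length-sequence ks xs ⟨
    length (sequence ks xs)                     ≤⟨ maximal _ (sequence-zeroSumFree {ks} {xs} narrow certified) ⟩
    d                                           ∎
    where open ≤-Reasoning

odd⇒suc-double : ∀ n → ¬ 2 ∣ n → ∃[ m ] n ≡ suc (2 * m)
odd⇒suc-double 0             2∤n = ⊥-elim (2∤n (divides-refl 0))
odd⇒suc-double 1             _   = 0 , refl
odd⇒suc-double (suc (suc n)) 2∤n with odd⇒suc-double n (2∤n ∘ ∣m∣n⇒∣m+n (divides-refl 1))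
... | m , refl = suc m , cong (2 +_) (sym (+-suc m (m + 0)))

kinds₁ kinds₂ kinds₃ kinds₄ : List Kind
kinds₁ = order-two ∷ window 1 ∷ window 1 ∷ window 2 ∷ window 2 ∷ []
kinds₂ = order-two ∷ order-two ∷ window 1 ∷ window 2 ∷ window 2 ∷ []
kinds₃ = order-two ∷ order-two ∷ order-two ∷ window 2 ∷ window 2 ∷ []
kinds₄ = order-two ∷ order-two ∷ order-two ∷ order-two ∷ window 2 ∷ []

extras₁ extras₂ extras₃ extras₄ : List (Vec (ℕ × ℕ) 5)
extras₁ = ((1 , 0) ∷ (1 , 1) ∷ (1 , 1) ∷ (2 , 3) ∷ (1 , 1) ∷ [])
        ∷ ((1 , 0) ∷ (1 , 3) ∷ (2 , 3) ∷ (1 , 1) ∷ (1 , 1) ∷ [])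
        ∷ ((1 , 0) ∷ (1 , 1) ∷ (1 , 3) ∷ (1 , 1) ∷ (2 , 3) ∷ [])
        ∷ ((1 , 0) ∷ (1 , 1) ∷ (0 , 1) ∷ (2 , 3) ∷ (2 , 3) ∷ [])
        ∷ ((1 , 0) ∷ (2 , 3) ∷ (1 , 1) ∷ (1 , 1) ∷ (1 , 3) ∷ [])
        ∷ ((1 , 0) ∷ (2 , 3) ∷ (1 , 1) ∷ (2 , 3) ∷ (0 , 1) ∷ [])
        ∷ ((1 , 0) ∷ (0 , 1) ∷ (2 , 3) ∷ (2 , 3) ∷ (1 , 1) ∷ [])
        ∷ ((1 , 0) ∷ (2 , 3) ∷ (2 , 3) ∷ (0 , 1) ∷ (2 , 3) ∷ [])
        ∷ []
extras₂ = ((1 , 0) ∷ (0 , 0) ∷ (1 , 1) ∷ (2 , 3) ∷ (1 , 1) ∷ [])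
        ∷ ((1 , 0) ∷ (0 , 0) ∷ (2 , 3) ∷ (0 , 1) ∷ (1 , 1) ∷ [])
        ∷ ((1 , 0) ∷ (0 , 0) ∷ (1 , 3) ∷ (1 , 1) ∷ (2 , 3) ∷ [])
        ∷ ((1 , 0) ∷ (0 , 0) ∷ (0 , 1) ∷ (2 , 3) ∷ (2 , 3) ∷ [])
        ∷ ((0 , 0) ∷ (1 , 0) ∷ (1 , 1) ∷ (1 , 1) ∷ (0 , 1) ∷ [])
        ∷ ((0 , 0) ∷ (1 , 0) ∷ (1 , 1) ∷ (2 , 3) ∷ (1 , 3) ∷ [])
        ∷ ((0 , 0) ∷ (1 , 0) ∷ (2 , 3) ∷ (1 , 1) ∷ (1 , 1) ∷ [])
        ∷ ((0 , 0) ∷ (1 , 0) ∷ (2 , 3) ∷ (2 , 3) ∷ (2 , 3) ∷ [])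
        ∷ []
extras₃ = ((1 , 0) ∷ (0 , 0) ∷ (0 , 0) ∷ (0 , 1) ∷ (1 , 1) ∷ [])
        ∷ ((0 , 0) ∷ (1 , 0) ∷ (0 , 0) ∷ (1 , 1) ∷ (1 , 3) ∷ [])
        ∷ ((0 , 0) ∷ (0 , 0) ∷ (1 , 0) ∷ (1 , 1) ∷ (1 , 1) ∷ [])
        ∷ ((1 , 0) ∷ (1 , 0) ∷ (1 , 0) ∷ (1 , 1) ∷ (1 , 1) ∷ [])
        ∷ ((1 , 0) ∷ (0 , 0) ∷ (0 , 0) ∷ (2 , 3) ∷ (2 , 3) ∷ [])
        ∷ ((0 , 0) ∷ (1 , 0) ∷ (0 , 0) ∷ (2 , 3) ∷ (0 , 1) ∷ [])
        ∷ ((0 , 0) ∷ (0 , 0) ∷ (1 , 0) ∷ (2 , 3) ∷ (2 , 3) ∷ [])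
        ∷ ((1 , 0) ∷ (1 , 0) ∷ (1 , 0) ∷ (2 , 3) ∷ (2 , 3) ∷ [])
        ∷ []
extras₄ = ((1 , 0) ∷ (0 , 0) ∷ (0 , 0) ∷ (0 , 0) ∷ (0 , 1) ∷ [])
        ∷ ((0 , 0) ∷ (1 , 0) ∷ (0 , 0) ∷ (0 , 0) ∷ (1 , 1) ∷ [])
        ∷ ((0 , 0) ∷ (0 , 0) ∷ (1 , 0) ∷ (0 , 0) ∷ (1 , 1) ∷ [])
        ∷ ((0 , 0) ∷ (0 , 0) ∷ (0 , 0) ∷ (1 , 0) ∷ (1 , 1) ∷ [])
        ∷ ((1 , 0) ∷ (1 , 0) ∷ (1 , 0) ∷ (0 , 0) ∷ (1 , 1) ∷ [])
        ∷ ((1 , 0) ∷ (1 , 0) ∷ (0 , 0) ∷ (1 , 0) ∷ (1 , 1) ∷ [])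
        ∷ ((1 , 0) ∷ (0 , 0) ∷ (1 , 0) ∷ (1 , 0) ∷ (1 , 1) ∷ [])
        ∷ []

theorem3p1 : (n i : ℕ) → 3 ≤ n → ¬ (2 ∣ n) → 1 ≤ i → i ≤ 4
    → (d : ℕ) → IsSmallD (moduli n i) d → dStar (moduli n i) < d
theorem3p1 n i 3≤n 2∤n 1≤i i≤4 d with odd⇒suc-double n 2∤n
... | m , refl = bound i 1≤i i≤4
  where
  open Construction m using (moduliOf; certified?; dStar<d)

  lowerBound : ∀ ks xs → True (all? (λ κ → slack κ ≤? 2) ks) → True (everySublist? (certified? ks) xs) →
               True (sum (map slack ks) <? length xs) → IsSmallD (moduliOf ks) d → dStar (moduliOf ks) < d
  lowerBound ks xs narrow certified short =
    dStar<d {ks} {xs} (All.map (λ w≤2 → ≤-<-trans w≤2 (≤-trans 3≤n (m≤n*m _ 2))) (toWitness narrow))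
            (toWitness certified) (toWitness short)

  bound : ∀ i → 1 ≤ i → i ≤ 4 → IsSmallD (moduli (suc (2 * m)) i) d → dStar (moduli (suc (2 * m)) i) < d
  bound 0 () _
  bound 1 _ _ = lowerBound kinds₁ extras₁ _ _ _
  bound 2 _ _ = lowerBound kinds₂ extras₂ _ _ _
  bound 3 _ _ = lowerBound kinds₃ extras₃ _ _ _
  bound 4 _ _ = lowerBound kinds₄ extras₄ _ _ _
  bound (suc (suc (suc (suc (suc _))))) _ (s≤s (s≤s (s≤s (s≤s ()))))
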